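{- Let $r$, $s$, $d$, $a_n$, $c$ be any integers with $r+1\neq d$, and let $n$ be a positive integer. Suppose $W_{r+s}\neq0$, $W_{s+d}\neq0$, $U_{r-d+1}\neq0$ and $U_{r-d}W_{s+d-1}\neq0$. Then \[ \begin{split} &\sum_{a_{n-1}=c}^{a_n}\sum_{a_{n-2}=c}^{a_{n-1}}\cdots\sum_{a_0=c}^{a_1}q^{a_0}\left(\frac{U_{r-d}}{U_{r-d+1}}\right)^{a_0}\left(\frac{W_{s+d-1}}{W_{s+d}}\right)^{a_0}\\ &\qquad=(-1)^nq^{n+a_n}U_{r-d}^n\left(\frac{U_{r-d}}{U_{r-d+1}}\right)^{a_n}\left(\frac{W_{s+d-1}}{W_{s+d}}\right)^{a_n}\left(\frac{W_{s+d-1}}{W_{r+s}}\right)^n\\ &\qquad\quad-q^{c-1}\left(\frac{U_{r-d}}{U_{r-d+1}}\right)^{c-1}\left(\frac{W_{s+d-1}}{W_{s+d}}\right)^{c-1}\sum_{j=0}^{n-1}(-1)^{n-j}q^{n-j}U_{r-d}^{n-j}\left(\frac{W_{s+d-1}}{W_{r+s}}\right)^{n-j}\binom{a_n+j-c}{j}. \end{split} \]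
   Context: Let $a,b,p,q$ be complex numbers with $p\neq0$, $q\neq0$. The Horadam sequence $W_j=W_j(a,b;p,q)$ is defined by $W_0=a$, $W_1=b$, $W_j=pW_{j-1}-qW_{j-2}$ for $j\ge2$, and extended to negative indices by $W_{j}=(pW_{j+1}-W_{j+2})/q$, so the recurrence holds for all integers $j$. $U_j=W_j(0,1;p,q)$ is the Lucas sequence of the first kind (same $p,q$). The left side is an iterated sum with $n$ summation signs: $a_{n-1}$ runs from $c$ to $a_n$, and for each $i$ the index $a_{i-1}$ runs from $c$ to $a_i$. Summation convention: for integers $m,M$, $\sum_{k=m}^{M}h(k)$ is the usual sum if $M\ge m$, equals $0$ if $M=m-1$, and equals $-\sum_{k=M+1}^{m-1}h(k)$ if $M\le m-2$. For an integer $N$ and a non-negative integer $j$, $\binom{N}{j}=N(N-1)\cdots(N-j+1)/j!$. -}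

module Defs where

open import Level using (Level; _⊔_) renaming (suc to lsuc)
open import Algebra.Bundles using (CommutativeRing)
open import Data.Nat as ℕ using (ℕ; zero; suc; _!)
open import Data.Nat.Properties using (_!≢0)
open import Data.Integer as ℤ using (ℤ; +_; -[1+_])
open import Data.Integer.DivMod using (_/ℕ_)
open import Data.Product using (_×_; _,_; proj₁)
open import Relation.Nullary using (¬_)

-- A field: a commutative ring with a multiplicative inverse for every
-- nonzero element (the value of _⁻¹ at 0# is irrelevant), and 0 ≠ 1.
-- The paper works over ℂ, which is an instance.
record Field (c ℓ : Level) : Set (lsuc (c ⊔ ℓ)) where
  field
    commutativeRing : CommutativeRing c ℓ
  open CommutativeRing commutativeRing public
  infix 8 _⁻¹
  field
    _⁻¹        : Carrier → Carrier
    ⁻¹-inverse : ∀ x → ¬ (x ≈ 0#) → x * (x ⁻¹) ≈ 1#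
    0≉1        : ¬ (0# ≈ 1#)

module _ {c ℓ : Level} (F : Field c ℓ) where
  open Field F

  div : Carrier → Carrier → Carrier
  div x y = x * (y ⁻¹)

  pow : Carrier → ℕ → Carrier
  pow x zero    = 1#
  pow x (suc n) = x * pow x n

  zpow : Carrier → ℤ → Carrier
  zpow x (+ n)      = pow x n
  zpow x -[1+ n ]   = pow (x ⁻¹) (suc n)

  fromℕ : ℕ → Carrier
  fromℕ zero    = 0#
  fromℕ (suc n) = 1# + fromℕ n

  fromℤ : ℤ → Carrier
  fromℤ (+ n)    = fromℕ n
  fromℤ -[1+ n ] = - fromℕ (suc n)

  -- Horadam sequence W_j(a,b;p,q) for all integers j.
  -- forward: (W_n , W_{n+1})
  horFw : Carrier → Carrier → Carrier → Carrier → ℕ → Carrier × Carrier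
  horFw a b p q zero    = a , b
  horFw a b p q (suc n) with horFw a b p q n
  ... | x , y = y , (p * y - q * x)

  -- backward: (W_{-n} , W_{-n+1}), using W_j = (p W_{j+1} - W_{j+2}) / q
  horBw : Carrier → Carrier → Carrier → Carrier → ℕ → Carrier × Carrier
  horBw a b p q zero    = a , b
  horBw a b p q (suc n) with horBw a b p q n
  ... | x , y = div (p * x - y) q , x

  Horadam : Carrier → Carrier → Carrier → Carrier → ℤ → Carrier
  Horadam a b p q (+ n)    = proj₁ (horFw a b p q n)
  Horadam a b p q -[1+ n ] = proj₁ (horBw a b p q (suc n))

  Lucas : Carrier → Carrier → ℤ → Carrier
  Lucas p q = Horadam 0# 1# p q

  sumℕ : ℕ → (ℕ → Carrier) → Carrier
  sumℕ zero    h = 0#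
  sumℕ (suc n) h = sumℕ n h + h n

  -- Σ_{k=m}^{M} h(k) with the paper's convention:
  -- usual sum if M ≥ m, 0 if M = m-1, -Σ_{k=M+1}^{m-1} h(k) if M ≤ m-2.
  -- Here t = M - m + 1; if t = +n the sum has n terms h(m+i), i<n;
  -- if t = -(n+1) then the range M+1..m-1 has n+1 terms h(M+1+i).
  sumℤ : ℤ → ℤ → (ℤ → Carrier) → Carrier
  sumℤ m M h with M ℤ.- m ℤ.+ ℤ.1ℤ
  ... | + n      = sumℕ n (λ i → h (m ℤ.+ + i))
  ... | -[1+ n ] = - sumℕ (suc n) (λ i → h (M ℤ.+ ℤ.1ℤ ℤ.+ + i))

  iterSum : ℤ → (ℤ → Carrier) → ℕ → ℤ → Carrier
  iterSum c f zero    x = f x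
  iterSum c f (suc n) x = sumℤ c x (iterSum c f n)

-- generalized binomial coefficient for integer N and natural j:
-- N(N-1)...(N-j+1)/j!  (the division is exact)
fallingℤ : ℤ → ℕ → ℤ
fallingℤ N zero    = ℤ.1ℤ
fallingℤ N (suc j) = fallingℤ N j ℤ.* (N ℤ.- + j)

binomℤ : ℤ → ℕ → ℤ
binomℤ N j = _/ℕ_ (fallingℤ N j) (j !) {{j !≢0}}

{-# OPTIONS --safe #-}
-- With X = q A B and y = −q U_{r−d} C, the summand is the geometric sequence
-- e(k) = X^k, and the Horadam addition formula
-- W_{r+s} = U_{r−d+1} W_{s+d} − q U_{r−d} W_{s+d−1} turns into y (X − 1) = X.
-- For any such X and y, the n-fold iterated sum of e starting at c is
-- G_n(M) = y^n e(M) − e(c−1) Σ_{j<n} y^{n−j} binom(M+j−c, j): Pascal's rule gives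
-- G_{n+1}(M) − G_{n+1}(M−1) = G_n(M), and binom(j, j+1) = 0 gives G_{n+1}(c−1) = 0,
-- so every summation sign telescopes.
module Submission where

open import Defs
open import Level using (Level)
open import Data.Nat using (ℕ; _∸_; _≥_)
open import Data.Integer using (ℤ; +_; 1ℤ) renaming (_+_ to _+ℤ_; _-_ to _-ℤ_)
open import Relation.Binary.PropositionalEquality using (_≢_)
open import Relation.Nullary using (¬_)

open import Data.Maybe using (Maybe; just; nothing)
open import Data.Nat as ℕ using (zero; suc; _!)
open import Data.Nat.Properties as ℕ using (_!≢0)
import Data.Nat.DivMod as ℕ
open import Data.Integer as ℤ using (-[1+_]; +[1+_]; 0ℤ) renaming (-_ to -ℤ_)
import Data.Integer.Properties as ℤ
open import Data.Integer.Tactic.RingSolver using (solve-∀)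
open import Data.Product using (_×_; _,_; proj₁; proj₂)
open import Relation.Binary.PropositionalEquality as ≡ using (_≡_)
open import Relation.Nullary using (yes; no)
open import Algebra.Solver.Ring.AlmostCommutativeRing
  using (AlmostCommutativeRing; fromCommutativeRing; _-Raw-AlmostCommutative⟶_)
import Algebra.Solver.Ring as RingSolver

ℤ-induction : ∀ {ℓ} (P : ℤ → Set ℓ) → P 0ℤ → (∀ i → P i → P (i +ℤ 1ℤ)) →
              (∀ i → P (i +ℤ 1ℤ) → P i) → ∀ i → P i
ℤ-induction P P0 up down (+ n) = nonneg n
  where
  nonneg : ∀ n → P (+ n)
  nonneg zero    = P0
  nonneg (suc n) = ≡.subst P (≡.cong +_ (ℕ.+-comm n 1)) (up (+ n) (nonneg n))
ℤ-induction P P0 up down -[1+ n ] = neg n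
  where
  neg : ∀ n → P -[1+ n ]
  neg zero    = down -[1+ 0 ] P0
  neg (suc n) = down -[1+ suc n ] (neg n)

module Binomial where
  open import Data.Integer using (_+_; _-_; _*_; _/ℕ_)
  open import Data.Integer.Divisibility.Signed using (_∣_; divides; ∣m∣n⇒∣m+n; ∣m+n∣n⇒∣m; *-monoʳ-∣)
  open ≡ using (refl; sym; cong; cong₂; subst)
  open ≡.≡-Reasoning

  k*n/ℕn≡k : ∀ k n .{{_ : ℕ.NonZero n}} → (k * + n) /ℕ n ≡ k
  k*n/ℕn≡k (+ m) n = begin
    (+ m * + n) /ℕ n ≡⟨ cong (_/ℕ n) (ℤ.pos-* m n) ⟨
    + (m ℕ.* n ℕ./ n) ≡⟨ cong +_ (ℕ.m*n/n≡m m n) ⟩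
    + m               ∎
  k*n/ℕn≡k -[1+ m ] (suc n)
    rewrite ℕ.m*n%n≡0 (suc m) (suc n) {{_}} | ℕ.m*n/n≡m (suc m) (suc n) {{_}} = refl

  fallingℤ-first-factor : ∀ N j → fallingℤ N (suc j) ≡ N * fallingℤ (N - 1ℤ) j
  fallingℤ-first-factor N zero = base N
    where
    base : ∀ N → 1ℤ * (N - 0ℤ) ≡ N * 1ℤ
    base = solve-∀
  fallingℤ-first-factor N (suc j) = begin
    fallingℤ N (suc j) * (N - + suc j)          ≡⟨ cong₂ _*_ (fallingℤ-first-factor N j) (cong (N -_) (ℤ.pos-+ 1 j)) ⟩
    N * fallingℤ (N - 1ℤ) j * (N - (1ℤ + + j))  ≡⟨ regroup N (fallingℤ (N - 1ℤ) j) (+ j) ⟩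
    N * (fallingℤ (N - 1ℤ) j * (N - 1ℤ - + j))  ∎
    where
    regroup : ∀ N X J → N * X * (N - (1ℤ + J)) ≡ N * (X * (N - 1ℤ - J))
    regroup = solve-∀

  fallingℤ-pascal : ∀ N j → fallingℤ (N + 1ℤ) (suc j) ≡ fallingℤ N (suc j) + + suc j * fallingℤ N j
  fallingℤ-pascal N j = begin
    fallingℤ (N + 1ℤ) (suc j)                       ≡⟨ fallingℤ-first-factor (N + 1ℤ) j ⟩
    (N + 1ℤ) * fallingℤ (N + 1ℤ - 1ℤ) j             ≡⟨ cong (λ M → (N + 1ℤ) * fallingℤ M j) (cancel N) ⟩
    (N + 1ℤ) * fallingℤ N j                         ≡⟨ split N (fallingℤ N j) (+ j) ⟩
    fallingℤ N j * (N - + j) + (1ℤ + + j) * fallingℤ N j ≡⟨ cong (λ k → fallingℤ N (suc j) + k * fallingℤ N j) (ℤ.pos-+ 1 j) ⟨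
    fallingℤ N (suc j) + + suc j * fallingℤ N j     ∎
    where
    cancel : ∀ N → N + 1ℤ - 1ℤ ≡ N
    cancel = solve-∀
    split : ∀ N X J → (N + 1ℤ) * X ≡ X * (N - J) + (1ℤ + J) * X
    split = solve-∀

  fallingℤ-zero : ∀ j → fallingℤ 0ℤ (suc j) ≡ 0ℤ
  fallingℤ-zero zero    = refl
  fallingℤ-zero (suc j) = cong (_* (0ℤ - + suc j)) (fallingℤ-zero j)

  [1+j]!≡[1+j]*j! : ∀ j → + (suc j !) ≡ + suc j * + (j !)
  [1+j]!≡[1+j]*j! j = ℤ.pos-* (suc j) (j !)

  factorial∣fallingℤ : ∀ j N → + (j !) ∣ fallingℤ N j
  factorial∣fallingℤ zero    N = divides (fallingℤ N 0) (sym (ℤ.*-identityʳ _))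
  factorial∣fallingℤ (suc j) = ℤ-induction (λ N → + (suc j !) ∣ fallingℤ N (suc j)) base up down
    where
    base : + (suc j !) ∣ fallingℤ 0ℤ (suc j)
    base = divides 0ℤ (fallingℤ-zero j)
    [1+j]!∣[1+j]* : ∀ N → + (suc j !) ∣ + suc j * fallingℤ N j
    [1+j]!∣[1+j]* N = subst (_∣ + suc j * fallingℤ N j) (sym ([1+j]!≡[1+j]*j! j)) (*-monoʳ-∣ (+ suc j) (factorial∣fallingℤ j N))
    up : ∀ N → + (suc j !) ∣ fallingℤ N (suc j) → + (suc j !) ∣ fallingℤ (N + 1ℤ) (suc j)
    up N ∣N = subst (_ ∣_) (sym (fallingℤ-pascal N j)) (∣m∣n⇒∣m+n ∣N ([1+j]!∣[1+j]* N))
    down : ∀ N → + (suc j !) ∣ fallingℤ (N + 1ℤ) (suc j) → + (suc j !) ∣ fallingℤ N (suc j)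
    down N ∣N+1 = ∣m+n∣n⇒∣m (subst (_ ∣_) (fallingℤ-pascal N j) ∣N+1) ([1+j]!∣[1+j]* N)

  fallingℤ≡binomℤ*factorial : ∀ N j → fallingℤ N j ≡ binomℤ N j * + (j !)
  fallingℤ≡binomℤ*factorial N j with factorial∣fallingℤ j N
  ... | divides k eq = begin
    fallingℤ N j                                ≡⟨ eq ⟩
    k * + (j !)                                 ≡⟨ cong (_* + (j !)) (k*n/ℕn≡k k (j !) {{j !≢0}}) ⟨
    _/ℕ_ (k * + (j !)) (j !) {{j !≢0}} * + (j !) ≡⟨ cong (λ x → _/ℕ_ x (j !) {{j !≢0}} * + (j !)) eq ⟨
    binomℤ N j * + (j !)                        ∎

  binomℤ-pascal : ∀ N j → binomℤ (N + 1ℤ) (suc j) ≡ binomℤ N (suc j) + binomℤ N j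
  binomℤ-pascal N j = ℤ.*-cancelʳ-≡ _ _ (+ (suc j !)) {{suc j !≢0}} (begin
    binomℤ (N + 1ℤ) (suc j) * + (suc j !)                       ≡⟨ fallingℤ≡binomℤ*factorial (N + 1ℤ) (suc j) ⟨
    fallingℤ (N + 1ℤ) (suc j)                                   ≡⟨ fallingℤ-pascal N j ⟩
    fallingℤ N (suc j) + + suc j * fallingℤ N j                 ≡⟨ cong₂ (λ x y → x + + suc j * y)
                                                                     (fallingℤ≡binomℤ*factorial N (suc j))
                                                                     (fallingℤ≡binomℤ*factorial N j) ⟩
    B₁ * + (suc j !) + + suc j * (B₀ * + (j !))                 ≡⟨ cong (λ f → B₁ * f + + suc j * (B₀ * + (j !))) ([1+j]!≡[1+j]*j! j) ⟩
    B₁ * (+ suc j * + (j !)) + + suc j * (B₀ * + (j !))         ≡⟨ collect B₁ B₀ (+ suc j) (+ (j !)) ⟩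
    (B₁ + B₀) * (+ suc j * + (j !))                             ≡⟨ cong ((B₁ + B₀) *_) ([1+j]!≡[1+j]*j! j) ⟨
    (B₁ + B₀) * + (suc j !)                                     ∎)
    where
    B₁ = binomℤ N (suc j)
    B₀ = binomℤ N j
    collect : ∀ a b s f → a * (s * f) + s * (b * f) ≡ (a + b) * (s * f)
    collect = solve-∀

  binomℤ-vanishes : ∀ j → binomℤ (+ j) (suc j) ≡ 0ℤ
  binomℤ-vanishes j = ℤ.*-cancelʳ-≡ _ _ (+ (suc j !)) {{suc j !≢0}} (begin
    binomℤ (+ j) (suc j) * + (suc j !) ≡⟨ fallingℤ≡binomℤ*factorial (+ j) (suc j) ⟨
    fallingℤ (+ j) j * (+ j - + j)     ≡⟨ cong (fallingℤ (+ j) j *_) (ℤ.+-inverseʳ (+ j)) ⟩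
    fallingℤ (+ j) j * 0ℤ              ≡⟨ ℤ.*-zeroʳ (fallingℤ (+ j) j) ⟩
    0ℤ                                 ≡⟨ ℤ.*-zeroˡ (+ (suc j !)) ⟨
    0ℤ * + (suc j !)                   ∎)

open Binomial using (binomℤ-pascal; binomℤ-vanishes)

module FieldProperties {c ℓ : Level} (F : Field c ℓ) where
  open Field F
  open import Relation.Binary.Reasoning.Setoid setoid
  open import Algebra.Properties.Ring ring using (-‿distribˡ-*; -‿distribʳ-*)
  open import Algebra.Properties.AbelianGroup +-abelianGroup using (⁻¹-∙-comm)
  open import Algebra.Properties.CommutativeSemigroup +-commutativeSemigroup using (interchange)
  open import Algebra.Properties.Group +-group using (ε⁻¹≈ε; ⁻¹-involutive)

  -- The integers in F, and a ring solver with integer coefficients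

  fromℕ-+ : ∀ m n → fromℕ F (m ℕ.+ n) ≈ fromℕ F m + fromℕ F n
  fromℕ-+ zero    n = sym (+-identityˡ _)
  fromℕ-+ (suc m) n = trans (+-congˡ (fromℕ-+ m n)) (sym (+-assoc _ _ _))

  fromℕ-* : ∀ m n → fromℕ F (m ℕ.* n) ≈ fromℕ F m * fromℕ F n
  fromℕ-* zero    n = sym (zeroˡ _)
  fromℕ-* (suc m) n = begin
    fromℕ F (n ℕ.+ m ℕ.* n)           ≈⟨ fromℕ-+ n (m ℕ.* n) ⟩
    fromℕ F n + fromℕ F (m ℕ.* n)     ≈⟨ +-cong (sym (*-identityˡ _)) (fromℕ-* m n) ⟩
    1# * fromℕ F n + fromℕ F m * fromℕ F n ≈⟨ distribʳ _ _ _ ⟨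
    (1# + fromℕ F m) * fromℕ F n      ∎

  fromℤ-⊖ : ∀ m n → fromℤ F (m ℤ.⊖ n) ≈ fromℕ F m - fromℕ F n
  fromℤ-⊖ m zero rewrite ℤ.⊖-≥ (ℕ.z≤n {m}) = sym (trans (+-congˡ ε⁻¹≈ε) (+-identityʳ _))
  fromℤ-⊖ zero (suc n) rewrite ℤ.⊖-≤ (ℕ.z≤n {suc n}) = sym (+-identityˡ _)
  fromℤ-⊖ (suc m) (suc n) rewrite ℤ.[1+m]⊖[1+n]≡m⊖n m n = begin
    fromℤ F (m ℤ.⊖ n)                          ≈⟨ fromℤ-⊖ m n ⟩
    fromℕ F m - fromℕ F n                      ≈⟨ +-identityˡ _ ⟨
    0# + (fromℕ F m - fromℕ F n)               ≈⟨ +-congʳ (-‿inverseʳ 1#) ⟨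
    (1# - 1#) + (fromℕ F m - fromℕ F n)        ≈⟨ interchange _ _ _ _ ⟩
    (1# + fromℕ F m) + (- 1# - fromℕ F n)      ≈⟨ +-congˡ (⁻¹-∙-comm _ _) ⟩
    (1# + fromℕ F m) - (1# + fromℕ F n)        ∎

  fromℤ-+ : ∀ i j → fromℤ F (i +ℤ j) ≈ fromℤ F i + fromℤ F j
  fromℤ-+ -[1+ m ] -[1+ n ] = begin
    - (1# + fromℕ F (suc (m ℕ.+ n)))            ≈⟨ -‿cong (+-congˡ (fromℕ-+ (suc m) n)) ⟩
    - (1# + (fromℕ F (suc m) + fromℕ F n))      ≈⟨ -‿cong (trans (sym (+-assoc _ _ _)) (+-congʳ (+-comm _ _))) ⟩
    - ((fromℕ F (suc m) + 1#) + fromℕ F n)      ≈⟨ -‿cong (+-assoc _ _ _) ⟩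
    - (fromℕ F (suc m) + fromℕ F (suc n))       ≈⟨ ⁻¹-∙-comm _ _ ⟨
    - fromℕ F (suc m) + - fromℕ F (suc n)       ∎
  fromℤ-+ -[1+ m ] (+ n)    = trans (fromℤ-⊖ n (suc m)) (+-comm _ _)
  fromℤ-+ (+ m)    -[1+ n ] = fromℤ-⊖ m (suc n)
  fromℤ-+ (+ m)    (+ n)    = fromℕ-+ m n

  fromℤ-neg : ∀ i → fromℤ F (ℤ.- i) ≈ - fromℤ F i
  fromℤ-neg (+ zero)  = sym ε⁻¹≈ε
  fromℤ-neg +[1+ n ]  = refl
  fromℤ-neg -[1+ n ]  = sym (⁻¹-involutive _)

  fromℤ-* : ∀ i j → fromℤ F (i ℤ.* j) ≈ fromℤ F i * fromℤ F j
  fromℤ-* i        (+ zero)  rewrite ℤ.*-zeroʳ i = sym (zeroʳ _)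
  fromℤ-* (+ zero) j         = sym (zeroˡ _)
  fromℤ-* +[1+ m ] +[1+ n ]  = fromℕ-* (suc m) (suc n)
  fromℤ-* +[1+ m ] -[1+ n ]  = trans (-‿cong (fromℕ-* (suc m) (suc n))) (-‿distribʳ-* _ _)
  fromℤ-* -[1+ m ] +[1+ n ]  = trans (-‿cong (fromℕ-* (suc m) (suc n))) (-‿distribˡ-* _ _)
  fromℤ-* -[1+ m ] -[1+ n ]  = begin
    fromℕ F (suc m ℕ.* suc n)                 ≈⟨ fromℕ-* (suc m) (suc n) ⟩
    fromℕ F (suc m) * fromℕ F (suc n)         ≈⟨ ⁻¹-involutive _ ⟨
    - - (fromℕ F (suc m) * fromℕ F (suc n))   ≈⟨ -‿cong (-‿distribˡ-* _ _) ⟩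
    - (- fromℕ F (suc m) * fromℕ F (suc n))   ≈⟨ -‿distribʳ-* _ _ ⟩
    - fromℕ F (suc m) * - fromℕ F (suc n)     ∎

  -- fromℤ, except that 1 goes to 1# on the nose: solver constants then
  -- evaluate to the literal 0# and 1# occurring in goals.
  coefficient : ℤ → Carrier
  coefficient (+ 1) = 1#
  coefficient i     = fromℤ F i

  coefficient≈fromℤ : ∀ i → coefficient i ≈ fromℤ F i
  coefficient≈fromℤ (+ 0)           = refl
  coefficient≈fromℤ (+ 1)           = sym (+-identityʳ 1#)
  coefficient≈fromℤ +[1+ suc n ]    = refl
  coefficient≈fromℤ -[1+ n ]        = refl

  private
    almostCommutativeRing : AlmostCommutativeRing c ℓ
    almostCommutativeRing = fromCommutativeRing commutativeRing

    coefficient-morphism : ℤ.+-*-rawRing -Raw-AlmostCommutative⟶ almostCommutativeRing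
    coefficient-morphism = record
      { ⟦_⟧    = coefficient
      ; +-homo = λ i j → transport (i +ℤ j) (fromℤ-+ i j) (+-cong (coefficient≈fromℤ i) (coefficient≈fromℤ j))
      ; *-homo = λ i j → transport (i ℤ.* j) (fromℤ-* i j) (*-cong (coefficient≈fromℤ i) (coefficient≈fromℤ j))
      ; -‿homo = λ i → transport (ℤ.- i) (fromℤ-neg i) (-‿cong (coefficient≈fromℤ i))
      ; 0-homo = refl
      ; 1-homo = refl
      }
      where
      transport : ∀ k {x y} → fromℤ F k ≈ x → y ≈ x → coefficient k ≈ y
      transport k e e′ = trans (coefficient≈fromℤ k) (trans e (sym e′))

    coefficient-≟ : ∀ i j → Maybe (coefficient i ≈ coefficient j)
    coefficient-≟ i j with i ℤ.≟ j
    ... | yes ≡.refl = just refl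
    ... | no _       = nothing

  open RingSolver ℤ.+-*-rawRing almostCommutativeRing coefficient-morphism coefficient-≟
    public using (solve; _:=_; _:+_; _:*_; :-_; _:-_; con)

  x*[x⁻¹*y]≈y : ∀ {x} → ¬ (x ≈ 0#) → ∀ y → x * (x ⁻¹ * y) ≈ y
  x*[x⁻¹*y]≈y {x} x≉0 y = begin
    x * (x ⁻¹ * y) ≈⟨ *-assoc _ _ _ ⟨
    x * x ⁻¹ * y   ≈⟨ *-congʳ (⁻¹-inverse x x≉0) ⟩
    1# * y         ≈⟨ *-identityˡ y ⟩
    y              ∎

  *-cancelˡ-nonzero : ∀ {x} → ¬ (x ≈ 0#) → ∀ {y z} → x * y ≈ x * z → y ≈ z
  *-cancelˡ-nonzero {x} x≉0 {y} {z} xy≈xz = begin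
    y              ≈⟨ x*[x⁻¹*y]≈y x≉0 y ⟨
    x * (x ⁻¹ * y) ≈⟨ *-congˡ (*-comm _ _) ⟩
    x * (y * x ⁻¹) ≈⟨ *-assoc _ _ _ ⟨
    x * y * x ⁻¹   ≈⟨ *-congʳ xy≈xz ⟩
    x * z * x ⁻¹   ≈⟨ *-assoc _ _ _ ⟩
    x * (z * x ⁻¹) ≈⟨ *-congˡ (*-comm _ _) ⟩
    x * (x ⁻¹ * z) ≈⟨ x*[x⁻¹*y]≈y x≉0 z ⟩
    z              ∎

  *-nonzero : ∀ {x y} → ¬ (x ≈ 0#) → ¬ (y ≈ 0#) → ¬ (x * y ≈ 0#)
  *-nonzero {x} x≉0 y≉0 xy≈0 = y≉0 (*-cancelˡ-nonzero x≉0 (trans xy≈0 (sym (zeroʳ x))))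

  ⁻¹-nonzero : ∀ {x} → ¬ (x ≈ 0#) → ¬ (x ⁻¹ ≈ 0#)
  ⁻¹-nonzero {x} x≉0 x⁻¹≈0 = 0≉1 (begin
    0#         ≈⟨ zeroʳ x ⟨
    x * 0#     ≈⟨ *-congˡ x⁻¹≈0 ⟨
    x * x ⁻¹   ≈⟨ ⁻¹-inverse x x≉0 ⟩
    1#         ∎)

  div-nonzero : ∀ {x y} → ¬ (x ≈ 0#) → ¬ (y ≈ 0#) → ¬ (div F x y ≈ 0#)
  div-nonzero x≉0 y≉0 = *-nonzero x≉0 (⁻¹-nonzero y≉0)

  nonzero-factorˡ : ∀ {x} y → ¬ (x * y ≈ 0#) → ¬ (x ≈ 0#)
  nonzero-factorˡ y xy≉0 x≈0 = xy≉0 (trans (*-congʳ x≈0) (zeroˡ y))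

  nonzero-factorʳ : ∀ x {y} → ¬ (x * y ≈ 0#) → ¬ (y ≈ 0#)
  nonzero-factorʳ x xy≉0 y≈0 = xy≉0 (trans (*-congˡ y≈0) (zeroʳ x))

  pow-distrib-* : ∀ x y n → pow F (x * y) n ≈ pow F x n * pow F y n
  pow-distrib-* x y zero    = sym (*-identityˡ 1#)
  pow-distrib-* x y (suc n) = trans (*-congˡ (pow-distrib-* x y n))
    (solve 4 (λ x y a b → x :* y :* (a :* b) := x :* a :* (y :* b)) refl x y (pow F x n) (pow F y n))

  Geometric : Carrier → (ℤ → Carrier) → Set ℓ
  Geometric x f = ∀ k → f (k +ℤ 1ℤ) ≈ x * f k

  geometric-* : ∀ {x y f g} → Geometric x f → Geometric y g → Geometric (x * y) (λ k → f k * g k)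
  geometric-* {x} {y} {f} {g} f-step g-step k = trans (*-cong (f-step k) (g-step k))
    (solve 4 (λ x y a b → x :* a :* (y :* b) := x :* y :* (a :* b)) refl x y (f k) (g k))

  zpow-geometric : ∀ {x} → ¬ (x ≈ 0#) → Geometric x (zpow F x)
  zpow-geometric x≉0 (+ n)        = reflexive (≡.cong (pow F _) (ℕ.+-comm n 1))
  zpow-geometric x≉0 -[1+ zero ]  = sym (x*[x⁻¹*y]≈y x≉0 1#)
  zpow-geometric x≉0 -[1+ suc n ] = sym (x*[x⁻¹*y]≈y x≉0 _)

  zpow-+ : ∀ {x} → ¬ (x ≈ 0#) → ∀ n k → zpow F x (+ n +ℤ k) ≈ pow F x n * zpow F x k
  zpow-+ {x} x≉0 zero    k = trans (reflexive (≡.cong (zpow F x) (ℤ.+-identityˡ k))) (sym (*-identityˡ _))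
  zpow-+ {x} x≉0 (suc n) k = begin
    zpow F x (+ suc n +ℤ k)      ≈⟨ reflexive (≡.cong (zpow F x) (reassoc n k)) ⟩
    zpow F x (+ n +ℤ k +ℤ 1ℤ)   ≈⟨ zpow-geometric x≉0 (+ n +ℤ k) ⟩
    x * zpow F x (+ n +ℤ k)      ≈⟨ *-congˡ (zpow-+ x≉0 n k) ⟩
    x * (pow F x n * zpow F x k)  ≈⟨ *-assoc _ _ _ ⟨
    pow F x (suc n) * zpow F x k  ∎
    where
    reassoc : ∀ n k → + suc n +ℤ k ≡ + n +ℤ k +ℤ 1ℤ
    reassoc n k = ≡.trans (≡.cong (_+ℤ k) (ℤ.pos-+ 1 n)) (shuffle (+ n) k)
      where
      shuffle : ∀ N K → 1ℤ +ℤ N +ℤ K ≡ N +ℤ K +ℤ 1ℤ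
      shuffle = solve-∀

  sumℕ-cong : ∀ n {f g : ℕ → Carrier} → (∀ i → f i ≈ g i) → sumℕ F n f ≈ sumℕ F n g
  sumℕ-cong zero    f≈g = refl
  sumℕ-cong (suc n) f≈g = +-cong (sumℕ-cong n f≈g) (f≈g n)

  sumℕ-zero : ∀ n {f : ℕ → Carrier} → (∀ i → f i ≈ 0#) → sumℕ F n f ≈ 0#
  sumℕ-zero zero    f≈0 = refl
  sumℕ-zero (suc n) f≈0 = trans (+-cong (sumℕ-zero n f≈0) (f≈0 n)) (+-identityˡ 0#)

  sumℕ-distrib-+ : ∀ n (f g : ℕ → Carrier) → sumℕ F n (λ i → f i + g i) ≈ sumℕ F n f + sumℕ F n g
  sumℕ-distrib-+ zero    f g = sym (+-identityˡ 0#)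
  sumℕ-distrib-+ (suc n) f g = trans (+-congʳ (sumℕ-distrib-+ n f g))
    (solve 4 (λ a b c d → (a :+ b) :+ (c :+ d) := (a :+ c) :+ (b :+ d)) refl (sumℕ F n f) (sumℕ F n g) (f n) (g n))

  sumℕ-suc : ∀ n (f : ℕ → Carrier) → sumℕ F (suc n) f ≈ f 0 + sumℕ F n (λ i → f (suc i))
  sumℕ-suc zero    f = +-comm _ _
  sumℕ-suc (suc n) f = trans (+-congʳ (sumℕ-suc n f)) (+-assoc _ _ _)

  sumℤ-cong : ∀ m M {f g : ℤ → Carrier} → (∀ k → f k ≈ g k) → sumℤ F m M f ≈ sumℤ F m M g
  sumℤ-cong m M f≈g with M -ℤ m +ℤ 1ℤ
  ... | + n      = sumℕ-cong n (λ _ → f≈g _)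
  ... | -[1+ n ] = -‿cong (sumℕ-cong (suc n) (λ _ → f≈g _))

  module _ {h g : ℤ → Carrier} (h≈Δg : ∀ k → h k ≈ g (k +ℤ 1ℤ) - g k) where

    sumℕ-telescope : ∀ m n → sumℕ F n (λ i → h (m +ℤ + i)) ≈ g (m +ℤ + n) - g m
    sumℕ-telescope m zero    = begin
      0#                   ≈⟨ -‿inverseʳ (g m) ⟨
      g m - g m            ≈⟨ +-congʳ (reflexive (≡.cong g (ℤ.+-identityʳ m))) ⟨
      g (m +ℤ + 0) - g m  ∎
    sumℕ-telescope m (suc n) = begin
      sumℕ F n (λ i → h (m +ℤ + i)) + h (m +ℤ + n)             ≈⟨ +-cong (sumℕ-telescope m n) (h≈Δg (m +ℤ + n)) ⟩
      (g (m +ℤ + n) - g m) + (g (m +ℤ + n +ℤ 1ℤ) - g (m +ℤ + n)) ≈⟨ solve 3 (λ a b c → (a :- b) :+ (c :- a) := c :- b) refl _ _ _ ⟩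
      g (m +ℤ + n +ℤ 1ℤ) - g m                                   ≈⟨ +-congʳ (reflexive (≡.cong g (reassoc m n))) ⟩
      g (m +ℤ + suc n) - g m                                      ∎
      where
      reassoc : ∀ m n → m +ℤ + n +ℤ 1ℤ ≡ m +ℤ + suc n
      reassoc m n = ≡.trans (ℤ.+-assoc m (+ n) 1ℤ) (≡.cong (m +ℤ_) (≡.cong +_ (ℕ.+-comm n 1)))

    sumℤ-telescope : ∀ m M → sumℤ F m M h ≈ g (M +ℤ 1ℤ) - g m
    sumℤ-telescope m M with M -ℤ m +ℤ 1ℤ in length
    ... | + n = begin
      sumℕ F n (λ i → h (m +ℤ + i)) ≈⟨ sumℕ-telescope m n ⟩
      g (m +ℤ + n) - g m            ≈⟨ +-congʳ (reflexive (≡.cong g upper)) ⟨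
      g (M +ℤ 1ℤ) - g m             ∎
      where
      upper : M +ℤ 1ℤ ≡ m +ℤ + n
      upper = ≡.trans (bound M m) (≡.cong (m +ℤ_) length)
        where
        bound : ∀ M m → M +ℤ 1ℤ ≡ m +ℤ (M -ℤ m +ℤ 1ℤ)
        bound = solve-∀
    ... | -[1+ n ] = begin
      - sumℕ F (suc n) (λ i → h (M +ℤ 1ℤ +ℤ + i)) ≈⟨ -‿cong (sumℕ-telescope (M +ℤ 1ℤ) (suc n)) ⟩
      - (g (M +ℤ 1ℤ +ℤ + suc n) - g (M +ℤ 1ℤ))   ≈⟨ -‿cong (+-congʳ (reflexive (≡.cong g lower))) ⟩
      - (g m - g (M +ℤ 1ℤ))                         ≈⟨ solve 2 (λ a b → :- (a :- b) := b :- a) refl (g m) (g (M +ℤ 1ℤ)) ⟩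
      g (M +ℤ 1ℤ) - g m                             ∎
      where
      lower : M +ℤ 1ℤ +ℤ + suc n ≡ m
      lower = ≡.trans (≡.cong (λ t → M +ℤ 1ℤ +ℤ (-ℤ t)) (≡.sym length)) (bound M m)
        where
        bound : ∀ M m → M +ℤ 1ℤ +ℤ (-ℤ (M -ℤ m +ℤ 1ℤ)) ≡ m
        bound = solve-∀

  -- Sequences satisfying the Horadam recurrence

  module _ (p q : Carrier) where

    Recurrent : (ℤ → Carrier) → Set ℓ
    Recurrent V = ∀ k → V (k +ℤ 1ℤ +ℤ 1ℤ) ≈ p * V (k +ℤ 1ℤ) - q * V k

    horadam-recurrent : ¬ (q ≈ 0#) → ∀ a b → Recurrent (Horadam F a b p q)
    horadam-recurrent q≉0 a b (+ n) = begin
      W (+ n +ℤ 1ℤ +ℤ 1ℤ)            ≈⟨ reflexive (≡.cong W (≡.trans (≡.cong (_+ℤ 1ℤ) +n+1≡) (≡.cong +_ (ℕ.+-comm (suc n) 1)))) ⟩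
      p * W (+ suc n) - q * W (+ n)  ≈⟨ +-congʳ (*-congˡ (reflexive (≡.cong W +n+1≡))) ⟨
      p * W (+ n +ℤ 1ℤ) - q * W (+ n) ∎
      where
      W = Horadam F a b p q
      +n+1≡ : + n +ℤ 1ℤ ≡ + suc n
      +n+1≡ = ≡.cong +_ (ℕ.+-comm n 1)
    horadam-recurrent q≉0 a b -[1+ n ] = begin
      W (-[1+ n ] +ℤ 1ℤ +ℤ 1ℤ)       ≈⟨ reflexive (horadam-backward₂ n) ⟩
      y                              ≈⟨ solve 2 (λ u y → y := u :- (u :- y)) refl (p * x) y ⟩
      p * x - (p * x - y)            ≈⟨ +-congˡ (-‿cong (x*[x⁻¹*y]≈y q≉0 (p * x - y))) ⟨
      p * x - q * ((q ⁻¹) * (p * x - y)) ≈⟨ +-congˡ (-‿cong (*-congˡ (*-comm _ _))) ⟩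
      p * x - q * div F (p * x - y) q  ≈⟨ +-congʳ (*-congˡ (reflexive (horadam-backward₁ n))) ⟨
      p * W (-[1+ n ] +ℤ 1ℤ) - q * W -[1+ n ] ∎
      where
      W = Horadam F a b p q
      horadam-backward₁ : ∀ n → W (-[1+ n ] +ℤ 1ℤ) ≡ proj₁ (horBw F a b p q n)
      horadam-backward₁ zero    = ≡.refl
      horadam-backward₁ (suc n) = ≡.refl
      horadam-backward₂ : ∀ n → W (-[1+ n ] +ℤ 1ℤ +ℤ 1ℤ) ≡ proj₂ (horBw F a b p q n)
      horadam-backward₂ zero    = ≡.refl
      horadam-backward₂ (suc n) = horadam-backward₁ n
      x = proj₁ (horBw F a b p q n)
      y = proj₂ (horBw F a b p q n)

    recurrent-unique : ¬ (q ≈ 0#) → ∀ {V V′} → Recurrent V → Recurrent V′ →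
                       V 0ℤ ≈ V′ 0ℤ → V 1ℤ ≈ V′ 1ℤ → ∀ k → V k ≈ V′ k
    recurrent-unique q≉0 {V} {V′} rec rec′ V0≈ V1≈ k =
      proj₁ (ℤ-induction Agree (V0≈ , V1≈) up down k)
      where
      Agree : ℤ → Set ℓ
      Agree k = V k ≈ V′ k × V (k +ℤ 1ℤ) ≈ V′ (k +ℤ 1ℤ)
      up : ∀ k → Agree k → Agree (k +ℤ 1ℤ)
      up k (Vk≈ , Vk+1≈) = Vk+1≈ , (begin
        V (k +ℤ 1ℤ +ℤ 1ℤ)               ≈⟨ rec k ⟩
        p * V (k +ℤ 1ℤ) - q * V k       ≈⟨ +-cong (*-congˡ Vk+1≈) (-‿cong (*-congˡ Vk≈)) ⟩
        p * V′ (k +ℤ 1ℤ) - q * V′ k     ≈⟨ rec′ k ⟨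
        V′ (k +ℤ 1ℤ +ℤ 1ℤ)              ∎)
      -- the recurrence runs backwards because q is invertible
      down : ∀ k → Agree (k +ℤ 1ℤ) → Agree k
      down k (Vk+1≈ , Vk+2≈) = *-cancelˡ-nonzero q≉0 (begin
        q * V k                                   ≈⟨ isolate (rec k) ⟩
        p * V (k +ℤ 1ℤ) - V (k +ℤ 1ℤ +ℤ 1ℤ)       ≈⟨ +-cong (*-congˡ Vk+1≈) (-‿cong Vk+2≈) ⟩
        p * V′ (k +ℤ 1ℤ) - V′ (k +ℤ 1ℤ +ℤ 1ℤ)     ≈⟨ isolate (rec′ k) ⟨
        q * V′ k                                  ∎) , Vk+1≈
        where
        isolate : ∀ {x y z} → x ≈ y - z → z ≈ y - x
        isolate {x} {y} {z} x≈y-z = begin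
          z             ≈⟨ solve 2 (λ y z → z := y :- (y :- z)) refl y z ⟩
          y - (y - z)   ≈⟨ +-congˡ (-‿cong x≈y-z) ⟨
          y - x         ∎

    horadam-addition : ¬ (q ≈ 0#) → ∀ a b m n →
      let W = Horadam F a b p q; U = Lucas F p q in
      W (m +ℤ n +ℤ 1ℤ) ≈ U (m +ℤ 1ℤ) * W (n +ℤ 1ℤ) - q * U m * W n
    horadam-addition q≉0 a b m n =
      recurrent-unique q≉0 {λ m → W (m +ℤ n +ℤ 1ℤ)} {λ m → U (m +ℤ 1ℤ) * W (n +ℤ 1ℤ) - q * U m * W n}
        recW recUW base₀ base₁ m
      where
      W = Horadam F a b p q
      U = Lucas F p q
      W-cong : ∀ {i j} → i ≡ j → W i ≈ W j
      W-cong i≡j = reflexive (≡.cong W i≡j)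
      recW : Recurrent (λ m → W (m +ℤ n +ℤ 1ℤ))
      recW m = begin
        W (m +ℤ 1ℤ +ℤ 1ℤ +ℤ n +ℤ 1ℤ)                       ≈⟨ W-cong (shift₂ m n) ⟩
        W (m +ℤ n +ℤ 1ℤ +ℤ 1ℤ +ℤ 1ℤ)                       ≈⟨ horadam-recurrent q≉0 a b (m +ℤ n +ℤ 1ℤ) ⟩
        p * W (m +ℤ n +ℤ 1ℤ +ℤ 1ℤ) - q * W (m +ℤ n +ℤ 1ℤ) ≈⟨ +-congʳ (*-congˡ (W-cong (shift₁ m n))) ⟨
        p * W (m +ℤ 1ℤ +ℤ n +ℤ 1ℤ) - q * W (m +ℤ n +ℤ 1ℤ) ∎
        where
        shift₁ : ∀ m n → m +ℤ 1ℤ +ℤ n +ℤ 1ℤ ≡ m +ℤ n +ℤ 1ℤ +ℤ 1ℤ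
        shift₁ = solve-∀
        shift₂ : ∀ m n → m +ℤ 1ℤ +ℤ 1ℤ +ℤ n +ℤ 1ℤ ≡ m +ℤ n +ℤ 1ℤ +ℤ 1ℤ +ℤ 1ℤ
        shift₂ = solve-∀
      recUW : Recurrent (λ m → U (m +ℤ 1ℤ) * W (n +ℤ 1ℤ) - q * U m * W n)
      recUW m = begin
        U₃ * x - q * U₂ * y                               ≈⟨ +-cong (*-congʳ (recU (m +ℤ 1ℤ))) (-‿cong (*-congʳ (*-congˡ (recU m)))) ⟩
        (p * U₂ - q * U₁) * x - q * (p * U₁ - q * U₀) * y ≈⟨ solve 7 (λ p q U₀ U₁ U₂ x y →
                                                                (p :* U₂ :- q :* U₁) :* x :- q :* (p :* U₁ :- q :* U₀) :* y
                                                             := p :* (U₂ :* x :- q :* U₁ :* y) :- q :* (U₁ :* x :- q :* U₀ :* y))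
                                                              refl p q U₀ U₁ U₂ x y ⟩
        p * (U₂ * x - q * U₁ * y) - q * (U₁ * x - q * U₀ * y) ∎
        where
        recU = horadam-recurrent q≉0 0# 1#
        x = W (n +ℤ 1ℤ)
        y = W n
        U₀ = U m
        U₁ = U (m +ℤ 1ℤ)
        U₂ = U (m +ℤ 1ℤ +ℤ 1ℤ)
        U₃ = U (m +ℤ 1ℤ +ℤ 1ℤ +ℤ 1ℤ)
      base₀ : W (0ℤ +ℤ n +ℤ 1ℤ) ≈ 1# * W (n +ℤ 1ℤ) - q * 0# * W n
      base₀ = trans (W-cong (≡.cong (_+ℤ 1ℤ) (ℤ.+-identityˡ n)))
        (solve 3 (λ q x y → x := con 1ℤ :* x :- q :* con 0ℤ :* y) refl q (W (n +ℤ 1ℤ)) (W n))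
      base₁ : W (1ℤ +ℤ n +ℤ 1ℤ) ≈ (p * 1# - q * 0#) * W (n +ℤ 1ℤ) - q * 1# * W n
      base₁ = begin
        W (1ℤ +ℤ n +ℤ 1ℤ)               ≈⟨ W-cong (≡.cong (_+ℤ 1ℤ) (ℤ.+-comm 1ℤ n)) ⟩
        W (n +ℤ 1ℤ +ℤ 1ℤ)               ≈⟨ horadam-recurrent q≉0 a b n ⟩
        p * W (n +ℤ 1ℤ) - q * W n       ≈⟨ solve 4 (λ p q x y → p :* x :- q :* y := (p :* con 1ℤ :- q :* con 0ℤ) :* x :- q :* con 1ℤ :* y)
                                             refl p q (W (n +ℤ 1ℤ)) (W n) ⟩
        (p * 1# - q * 0#) * W (n +ℤ 1ℤ) - q * 1# * W n ∎

  -- Iterated sums of a geometric sequence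

  module _ (c₀ : ℤ) (X y : Carrier) (y[X-1]≈X : y * (X - 1#) ≈ X)
           (e : ℤ → Carrier) (e-step : Geometric X e) where

    binomial : ℤ → ℕ → Carrier
    binomial M j = fromℤ F (binomℤ (M +ℤ + j -ℤ c₀) j)

    binomialSum : ℕ → ℤ → Carrier
    binomialSum n M = sumℕ F n (λ j → pow F y (n ∸ j) * binomial M j)

    closedForm : ℕ → ℤ → Carrier
    closedForm n M = pow F y n * e M - e (c₀ -ℤ 1ℤ) * binomialSum n M

    binomial-pascal : ∀ M j → binomial M (suc j) ≈ binomial (M -ℤ 1ℤ) (suc j) + binomial M j
    binomial-pascal M j = begin
      fromℤ F (binomℤ (M +ℤ + suc j -ℤ c₀) (suc j))        ≈⟨ reflexive (≡.cong (λ N → fromℤ F (binomℤ N (suc j))) top) ⟩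
      fromℤ F (binomℤ (N +ℤ 1ℤ) (suc j))                   ≈⟨ reflexive (≡.cong (fromℤ F) (binomℤ-pascal N j)) ⟩
      fromℤ F (binomℤ N (suc j) +ℤ binomℤ N j)             ≈⟨ fromℤ-+ (binomℤ N (suc j)) (binomℤ N j) ⟩
      fromℤ F (binomℤ N (suc j)) + binomial M j            ≈⟨ +-congʳ (reflexive (≡.cong (λ N → fromℤ F (binomℤ N (suc j))) bottom)) ⟨
      binomial (M -ℤ 1ℤ) (suc j) + binomial M j            ∎
      where
      N = M +ℤ + j -ℤ c₀
      top : M +ℤ + suc j -ℤ c₀ ≡ N +ℤ 1ℤ
      top = ≡.trans (≡.cong (λ J → M +ℤ J -ℤ c₀) (ℤ.pos-+ 1 j)) (shuffle M (+ j) c₀)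
        where
        shuffle : ∀ M J c → M +ℤ (1ℤ +ℤ J) -ℤ c ≡ M +ℤ J -ℤ c +ℤ 1ℤ
        shuffle = solve-∀
      bottom : M -ℤ 1ℤ +ℤ + suc j -ℤ c₀ ≡ N
      bottom = ≡.trans (≡.cong (λ J → M -ℤ 1ℤ +ℤ J -ℤ c₀) (ℤ.pos-+ 1 j)) (shuffle M (+ j) c₀)
        where
        shuffle : ∀ M J c → M -ℤ 1ℤ +ℤ (1ℤ +ℤ J) -ℤ c ≡ M +ℤ J -ℤ c
        shuffle = solve-∀

    binomial-vanishes : ∀ j → binomial (c₀ -ℤ 1ℤ) (suc j) ≈ 0#
    binomial-vanishes j = reflexive (≡.cong (fromℤ F) (≡.trans (≡.cong (λ N → binomℤ N (suc j)) diagonal) (binomℤ-vanishes j)))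
      where
      diagonal : c₀ -ℤ 1ℤ +ℤ + suc j -ℤ c₀ ≡ + j
      diagonal = ≡.trans (≡.cong (λ J → c₀ -ℤ 1ℤ +ℤ J -ℤ c₀) (ℤ.pos-+ 1 j)) (cancel c₀ (+ j))
        where
        cancel : ∀ c J → c -ℤ 1ℤ +ℤ (1ℤ +ℤ J) -ℤ c ≡ J
        cancel = solve-∀

    binomialSum-difference : ∀ n M → binomialSum (suc n) M ≈ binomialSum (suc n) (M -ℤ 1ℤ) + binomialSum n M
    binomialSum-difference n M = begin
      binomialSum (suc n) M
        ≈⟨ sumℕ-suc n _ ⟩
      y′ * binomial M 0 + sumℕ F n (λ j → pow F y (n ∸ j) * binomial M (suc j))
        ≈⟨ +-congˡ (sumℕ-cong n (λ j → trans (*-congˡ (binomial-pascal M j)) (distribˡ _ _ _))) ⟩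
      y′ * binomial M 0 + sumℕ F n (λ j → pow F y (n ∸ j) * binomial (M -ℤ 1ℤ) (suc j) + pow F y (n ∸ j) * binomial M j)
        ≈⟨ +-congˡ (sumℕ-distrib-+ n _ _) ⟩
      y′ * binomial M 0 + (sumℕ F n (λ j → pow F y (n ∸ j) * binomial (M -ℤ 1ℤ) (suc j)) + binomialSum n M)
        ≈⟨ +-assoc _ _ _ ⟨
      (y′ * binomial (M -ℤ 1ℤ) 0 + sumℕ F n (λ j → pow F y (n ∸ j) * binomial (M -ℤ 1ℤ) (suc j))) + binomialSum n M
        ≈⟨ +-congʳ (sumℕ-suc n _) ⟨
      binomialSum (suc n) (M -ℤ 1ℤ) + binomialSum n M
        ∎
      where
      y′ = pow F y (suc n)

    closedForm-difference : ∀ n M → closedForm (suc n) M - closedForm (suc n) (M -ℤ 1ℤ) ≈ closedForm n M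
    closedForm-difference n M = begin
      (y * Y * e M - e₀ * binomialSum (suc n) M) - (y * Y * e M′ - e₀ * binomialSum (suc n) M′)
        ≈⟨ +-congʳ (+-cong (*-congˡ eM≈) (-‿cong (*-congˡ (binomialSum-difference n M)))) ⟩
      (y * Y * (X * e M′) - e₀ * (binomialSum (suc n) M′ + S)) - (y * Y * e M′ - e₀ * binomialSum (suc n) M′)
        ≈⟨ solve 7 (λ X y Y e′ e₀ S′ S →
                        (y :* Y :* (X :* e′) :- e₀ :* (S′ :+ S)) :- (y :* Y :* e′ :- e₀ :* S′)
                     := Y :* (y :* (X :- con 1ℤ)) :* e′ :- e₀ :* S)
             refl X y Y (e M′) e₀ (binomialSum (suc n) M′) S ⟩
      Y * (y * (X - 1#)) * e M′ - e₀ * S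
        ≈⟨ +-congʳ (*-congʳ (*-congˡ y[X-1]≈X)) ⟩
      Y * X * e M′ - e₀ * S
        ≈⟨ +-congʳ (trans (*-assoc _ _ _) (*-congˡ (sym eM≈))) ⟩
      Y * e M - e₀ * S
        ∎
      where
      Y = pow F y n
      e₀ = e (c₀ -ℤ 1ℤ)
      S = binomialSum n M
      M′ = M -ℤ 1ℤ
      eM≈ : e M ≈ X * e M′
      eM≈ = trans (reflexive (≡.cong e (≡.sym (cancel M)))) (e-step M′)
        where
        cancel : ∀ M → M -ℤ 1ℤ +ℤ 1ℤ ≡ M
        cancel = solve-∀

    closedForm-start : ∀ n → closedForm (suc n) (c₀ -ℤ 1ℤ) ≈ 0#
    closedForm-start n = begin
      y′ * e₀ - e₀ * binomialSum (suc n) (c₀ -ℤ 1ℤ)                  ≈⟨ +-congˡ (-‿cong (*-congˡ (sumℕ-suc n _))) ⟩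
      y′ * e₀ - e₀ * (y′ * (1# + 0#) + sumℕ F n (λ j → pow F y (n ∸ j) * binomial (c₀ -ℤ 1ℤ) (suc j)))
        ≈⟨ +-congˡ (-‿cong (*-congˡ (+-congˡ (sumℕ-zero n (λ j → trans (*-congˡ (binomial-vanishes j)) (zeroʳ _)))))) ⟩
      y′ * e₀ - e₀ * (y′ * (1# + 0#) + 0#)                           ≈⟨ solve 2 (λ y′ e₀ → y′ :* e₀ :- e₀ :* (y′ :* (con 1ℤ :+ con 0ℤ) :+ con 0ℤ) := con 0ℤ)
                                                                           refl y′ e₀ ⟩
      0#                                                              ∎
      where
      y′ = pow F y (suc n)
      e₀ = e (c₀ -ℤ 1ℤ)

    iterSum-closedForm : ∀ n M → iterSum F c₀ e n M ≈ closedForm n M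
    iterSum-closedForm zero    M = solve 2 (λ e e₀ → e := con 1ℤ :* e :- e₀ :* con 0ℤ) refl (e M) (e (c₀ -ℤ 1ℤ))
    iterSum-closedForm (suc n) M = begin
      sumℤ F c₀ M (iterSum F c₀ e n)                                     ≈⟨ sumℤ-cong c₀ M (iterSum-closedForm n) ⟩
      sumℤ F c₀ M (closedForm n)                                         ≈⟨ sumℤ-telescope difference c₀ M ⟩
      closedForm (suc n) (M +ℤ 1ℤ -ℤ 1ℤ) - closedForm (suc n) (c₀ -ℤ 1ℤ) ≈⟨ +-cong (reflexive (≡.cong (closedForm (suc n)) (cancel M)))
                                                                                   (-‿cong (closedForm-start n)) ⟩
      closedForm (suc n) M - 0#                                          ≈⟨ solve 1 (λ x → x :- con 0ℤ := x) refl _ ⟩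
      closedForm (suc n) M                                               ∎
      where
      cancel : ∀ M → M +ℤ 1ℤ -ℤ 1ℤ ≡ M
      cancel = solve-∀
      difference : ∀ k → closedForm n k ≈ closedForm (suc n) (k +ℤ 1ℤ -ℤ 1ℤ) - closedForm (suc n) (k -ℤ 1ℤ)
      difference k = trans (sym (closedForm-difference n k))
        (+-congʳ (reflexive (≡.cong (closedForm (suc n)) (≡.sym (cancel k)))))

  y[X-1]≈X : ∀ {q u₀ u₁ w₀ w₁ w} → ¬ (u₁ ≈ 0#) → ¬ (w₁ ≈ 0#) → ¬ (w ≈ 0#) →
             w ≈ u₁ * w₁ - q * u₀ * w₀ →
             (- 1# * q * u₀ * div F w₀ w) * (q * div F u₀ u₁ * div F w₀ w₁ - 1#) ≈ q * div F u₀ u₁ * div F w₀ w₁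
  y[X-1]≈X {q} {u₀} {u₁} {w₀} {w₁} {w} u₁≉0 w₁≉0 w≉0 w≈ = begin
    (- 1# * q * u₀ * (w₀ * w′)) * (q * (u₀ * u₁′) * (w₀ * w₁′) - 1#)
      ≈⟨ *-congˡ (+-congˡ (-‿cong one≈)) ⟩
    (- 1# * q * u₀ * (w₀ * w′)) * (q * (u₀ * u₁′) * (w₀ * w₁′) - (u₁ * u₁′) * (w₁ * w₁′))
      ≈⟨ solve 9 (λ q u₀ u₁ w₀ w₁ w′ u₁′ w₁′ w →
              (:- con 1ℤ :* q :* u₀ :* (w₀ :* w′)) :* (q :* (u₀ :* u₁′) :* (w₀ :* w₁′) :- (u₁ :* u₁′) :* (w₁ :* w₁′))
           := q :* u₀ :* u₁′ :* w₀ :* w₁′ :* w′ :* (u₁ :* w₁ :- q :* u₀ :* w₀))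
           refl q u₀ u₁ w₀ w₁ w′ u₁′ w₁′ w ⟩
    q * u₀ * u₁′ * w₀ * w₁′ * w′ * (u₁ * w₁ - q * u₀ * w₀)
      ≈⟨ *-congˡ w≈ ⟨
    q * u₀ * u₁′ * w₀ * w₁′ * w′ * w
      ≈⟨ solve 7 (λ q u₀ w₀ w′ u₁′ w₁′ w →
              q :* u₀ :* u₁′ :* w₀ :* w₁′ :* w′ :* w := q :* (u₀ :* u₁′) :* (w₀ :* w₁′) :* (w :* w′))
           refl q u₀ w₀ w′ u₁′ w₁′ w ⟩
    q * (u₀ * u₁′) * (w₀ * w₁′) * (w * w′)
      ≈⟨ trans (*-congˡ (⁻¹-inverse w w≉0)) (*-identityʳ _) ⟩
    q * (u₀ * u₁′) * (w₀ * w₁′)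
      ∎
    where
    u₁′ = u₁ ⁻¹
    w₁′ = w₁ ⁻¹
    w′  = w ⁻¹
    one≈ : 1# ≈ (u₁ * u₁′) * (w₁ * w₁′)
    one≈ = sym (trans (*-cong (⁻¹-inverse u₁ u₁≉0) (⁻¹-inverse w₁ w₁≉0)) (*-identityʳ 1#))

theorem7 : ∀ {c ℓ : Level} (F : Field c ℓ) →
  let open Field F in
  (a b p q : Carrier) → ¬ (p ≈ 0#) → ¬ (q ≈ 0#) →
  (r s d aₙ cc : ℤ) → (n : ℕ) → r +ℤ 1ℤ ≢ d → n ≥ 1 →
  let W  = Horadam F a b p q
      U  = Lucas F p q
      A  = div F (U (r -ℤ d)) (U (r -ℤ d +ℤ 1ℤ))
      B  = div F (W (s +ℤ d -ℤ 1ℤ)) (W (s +ℤ d))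
      C  = div F (W (s +ℤ d -ℤ 1ℤ)) (W (r +ℤ s))
      qz = zpow F q
  in
  ¬ (W (r +ℤ s) ≈ 0#) → ¬ (W (s +ℤ d) ≈ 0#) → ¬ (U (r -ℤ d +ℤ 1ℤ) ≈ 0#) →
  ¬ ((U (r -ℤ d) * W (s +ℤ d -ℤ 1ℤ)) ≈ 0#) →
  iterSum F cc (λ a₀ → qz a₀ * zpow F A a₀ * zpow F B a₀) n aₙ
    ≈ ((pow F (- 1#) n * qz (+ n +ℤ aₙ) * pow F (U (r -ℤ d)) n
          * zpow F A aₙ * zpow F B aₙ * pow F C n)
       - (qz (cc -ℤ 1ℤ) * zpow F A (cc -ℤ 1ℤ) * zpow F B (cc -ℤ 1ℤ)
          * sumℕ F n (λ j → pow F (- 1#) (n ∸ j) * pow F q (n ∸ j)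
                              * pow F (U (r -ℤ d)) (n ∸ j) * pow F C (n ∸ j)
                              * fromℤ F (binomℤ (aₙ +ℤ + j -ℤ cc) j))))
theorem7 F a b p q _ q≉0 r s d aₙ cc n _ _ w≉0 w₁≉0 u₁≉0 u₀w₀≉0 =
  trans (iterSum-closedForm cc X y (y[X-1]≈X u₁≉0 w₁≉0 w≉0 addition) e e-step n aₙ)
        (+-cong (sym leading) (-‿cong (*-congˡ (sumℕ-cong n (λ j → *-congʳ (pow-y (n ∸ j)))))))
  where
  open Field F
  open FieldProperties F
  open import Relation.Binary.Reasoning.Setoid setoid
  W = Horadam F a b p q
  U = Lucas F p q
  u₀ = U (r -ℤ d)
  u₁ = U (r -ℤ d +ℤ 1ℤ)
  w₀ = W (s +ℤ d -ℤ 1ℤ)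
  w₁ = W (s +ℤ d)
  A = div F u₀ u₁
  B = div F w₀ w₁
  C = div F w₀ (W (r +ℤ s))
  X = q * A * B
  y = - 1# * q * u₀ * C

  addition : W (r +ℤ s) ≈ u₁ * w₁ - q * u₀ * w₀
  addition = begin
    W (r +ℤ s)                                          ≈⟨ reflexive (≡.cong W (split r s d)) ⟩
    W (r -ℤ d +ℤ (s +ℤ d -ℤ 1ℤ) +ℤ 1ℤ)                 ≈⟨ horadam-addition p q q≉0 a b (r -ℤ d) (s +ℤ d -ℤ 1ℤ) ⟩
    u₁ * W (s +ℤ d -ℤ 1ℤ +ℤ 1ℤ) - q * u₀ * w₀          ≈⟨ +-congʳ (*-congˡ (reflexive (≡.cong W (cancel s d)))) ⟩
    u₁ * w₁ - q * u₀ * w₀                               ∎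
    where
    split : ∀ r s d → r +ℤ s ≡ r -ℤ d +ℤ (s +ℤ d -ℤ 1ℤ) +ℤ 1ℤ
    split = solve-∀
    cancel : ∀ s d → s +ℤ d -ℤ 1ℤ +ℤ 1ℤ ≡ s +ℤ d
    cancel = solve-∀

  e : ℤ → Carrier
  e k = zpow F q k * zpow F A k * zpow F B k

  e-step : Geometric X e
  e-step = geometric-* (geometric-* (zpow-geometric q≉0) (zpow-geometric A≉0)) (zpow-geometric B≉0)
    where
    A≉0 = div-nonzero (nonzero-factorˡ w₀ u₀w₀≉0) u₁≉0
    B≉0 = div-nonzero (nonzero-factorʳ u₀ u₀w₀≉0) w₁≉0

  pow-y : ∀ m → pow F y m ≈ pow F (- 1#) m * pow F q m * pow F u₀ m * pow F C m
  pow-y m = trans (pow-distrib-* _ _ m) (*-congʳ (trans (pow-distrib-* _ _ m) (*-congʳ (pow-distrib-* _ _ m))))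

  leading : pow F (- 1#) n * zpow F q (+ n +ℤ aₙ) * pow F u₀ n * zpow F A aₙ * zpow F B aₙ * pow F C n ≈ pow F y n * e aₙ
  leading = begin
    pow F (- 1#) n * zpow F q (+ n +ℤ aₙ) * pow F u₀ n * zpow F A aₙ * zpow F B aₙ * pow F C n
      ≈⟨ *-congʳ (*-congʳ (*-congʳ (*-congʳ (*-congˡ (zpow-+ q≉0 n aₙ))))) ⟩
    pow F (- 1#) n * (pow F q n * zpow F q aₙ) * pow F u₀ n * zpow F A aₙ * zpow F B aₙ * pow F C n
      ≈⟨ solve 7 (λ m Q z u a b c → m :* (Q :* z) :* u :* a :* b :* c := m :* Q :* u :* c :* (z :* a :* b))
           refl (pow F (- 1#) n) (pow F q n) (zpow F q aₙ) (pow F u₀ n) (zpow F A aₙ) (zpow F B aₙ) (pow F C n) ⟩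
    pow F (- 1#) n * pow F q n * pow F u₀ n * pow F C n * e aₙ
      ≈⟨ *-congʳ (pow-y n) ⟨
    pow F y n * e aₙ
      ∎
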